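{- Let $(X,R)$ be an object-free category, with partial composition $x\cdot y$ and set of units $E$ as defined in the context. Then for all $x,y,z\in X$: (i) $D^x_y\wedge D^{x\cdot y}_z \iff D^y_z\wedge D^x_{y\cdot z}$; (ii) $D^x_y\wedge D^{x\cdot y}_z \Rightarrow (x\cdot y)\cdot z = x\cdot(y\cdot z)$; (iii) for every $x\in X$ there is $e\in E$ with $D^e_x$, and for every $x\in X$ there is $e\in E$ with $D^x_e$; (iv) $D^x_y\wedge D^y_z \Rightarrow D^{x\cdot y}_z$.
   Context: For a set $X$ and a ternary relation $R\subseteq X\times X\times X$ write $R^x_{yz}$ for $(x,y,z)\in R$, and define $D^y_z \iff \exists x.\ R^x_{yz}$. $R$ is a partial operation if for all $y,z$ there is at most one $x$ with $R^x_{yz}$. $R$ is relationally associative if for all $u,x,y,z$: $(\exists v.\ R^u_{xv}\wedge R^v_{yz})\iff(\exists v.\ R^u_{vz}\wedge R^v_{xy})$. $R$ is coherent if $R^v_{xy}\wedge D^y_z\Rightarrow D^v_z$ for all $v,x,y,z$. An element $e$ is a relational left unit of $R$ if $\exists x.\ R^x_{ex}$ and $\forall x,y.\ R^y_{ex}\Rightarrow y=x$; it is a relational right unit if $\exists x.\ R^x_{xe}$ and $\forall x,y.\ R^y_{xe}\Rightarrow y=x$; $E$ is the set of elements that are relational left or right units. A relational semigroup is $(X,R)$ with $R$ relationally associative. A relational monoid is a relational semigroup such that for every $x\in X$ there are $e,e'\in E$ with $D^e_x$ and $D^x_{e'}$; it is a partial monoid if moreover $R$ is a partial operation. An object-free category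 is a partial monoid in which $R$ is coherent. In a partial monoid, whenever $D^x_y$, $x\cdot y$ denotes the unique $z$ with $R^z_{xy}$. -}

module Defs where

open import Level using (Level; _⊔_)
open import Data.Product using (Σ; ∃; ∃-syntax; _×_; _,_; proj₁)
open import Data.Sum using (_⊎_)
open import Relation.Binary.PropositionalEquality using (_≡_)
open import Function.Bundles using (_⇔_)

-- A ternary relation on X:  R x y z  means  R^x_{yz}, i.e. (x,y,z) ∈ R.
Ternary : ∀ {a} (X : Set a) (ℓ : Level) → Set (a ⊔ Level.suc ℓ)
Ternary X ℓ = X → X → X → Set ℓ

module _ {a ℓ} {X : Set a} (R : Ternary X ℓ) where

  D : X → X → Set (a ⊔ ℓ)
  D y z = ∃[ x ] R x y z

  IsPartialOperation : Set (a ⊔ ℓ)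
  IsPartialOperation = ∀ {x x' y z} → R x y z → R x' y z → x ≡ x'

  IsRelationallyAssociative : Set (a ⊔ ℓ)
  IsRelationallyAssociative = ∀ u x y z →
    (∃[ v ] (R u x v × R v y z)) ⇔ (∃[ v ] (R u v z × R v x y))

  IsCoherent : Set (a ⊔ ℓ)
  IsCoherent = ∀ {v x y z} → R v x y → D y z → D v z

  IsLeftUnit : X → Set (a ⊔ ℓ)
  IsLeftUnit e = (∃[ x ] R x e x) × (∀ {x y} → R y e x → y ≡ x)

  IsRightUnit : X → Set (a ⊔ ℓ)
  IsRightUnit e = (∃[ x ] R x x e) × (∀ {x y} → R y x e → y ≡ x)

  InE : X → Set (a ⊔ ℓ)
  InE e = IsLeftUnit e ⊎ IsRightUnit e

  IsRelationalMonoid : Set (a ⊔ ℓ)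
  IsRelationalMonoid =
    IsRelationallyAssociative ×
    (∀ x → (∃[ e ] (InE e × D e x)) × (∃[ e' ] (InE e' × D x e')))

  IsPartialMonoid : Set (a ⊔ ℓ)
  IsPartialMonoid = IsRelationalMonoid × IsPartialOperation

  IsObjectFreeCategory : Set (a ⊔ ℓ)
  IsObjectFreeCategory = IsPartialMonoid × IsCoherent

  -- In a partial monoid, x · y is the unique z with R^z_{xy}; given a
  -- proof of D^x_y it is its witness (unique by IsPartialOperation).
  infixl 7 _·⟨_⟩
  _·⟨_⟩ : ∀ {x y} → X → D x y → X
  _ ·⟨ d ⟩ = proj₁ d

-- Relational associativity alone gives (i) and (ii): a witness u of R^u_{(xy)z}
-- is, by associativity, also a witness of R^u_{x(yz)}, so the two composites in
-- (ii) are the same element. (iii) is the unit axiom of a relational monoid and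
-- (iv) is coherence.
module Submission where

open import Defs
open import Data.Product using (Σ; ∃-syntax; _×_; _,_; proj₁; proj₂)
open import Relation.Binary.PropositionalEquality using (_≡_; refl)
open import Function.Bundles using (_⇔_; mk⇔; Equivalence)

module _ {a ℓ} {X : Set a} {R : Ternary X ℓ} where

  private
    infixl 7 _∙⟨_⟩
    _∙⟨_⟩ : ∀ {x y} → X → D R x y → X
    _∙⟨_⟩ = _·⟨_⟩ R

  module RelationalSemigroup (assoc : IsRelationallyAssociative R) where

    ·-assoc : ∀ {x y z} (dxy : D R x y) (dxy-z : D R (x ∙⟨ dxy ⟩) z) →
              Σ (D R y z) λ dyz → Σ (D R x (y ∙⟨ dyz ⟩)) λ dx-yz →
                (x ∙⟨ dxy ⟩) ∙⟨ dxy-z ⟩ ≡ x ∙⟨ dx-yz ⟩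
    ·-assoc {x} {y} {z} (w , Rwxy) (u , Ruwz)
      with Equivalence.from (assoc u x y z) (w , Ruwz , Rwxy)
    ... | v , Ruxv , Rvyz = (v , Rvyz) , (u , Ruxv) , refl

    D-assocʳ : ∀ {x y z} → Σ (D R x y) (λ dxy → D R (x ∙⟨ dxy ⟩) z) →
               Σ (D R y z) (λ dyz → D R x (y ∙⟨ dyz ⟩))
    D-assocʳ (dxy , dxy-z) with ·-assoc dxy dxy-z
    ... | dyz , dx-yz , _ = dyz , dx-yz

    D-assocˡ : ∀ {x y z} → Σ (D R y z) (λ dyz → D R x (y ∙⟨ dyz ⟩)) →
               Σ (D R x y) (λ dxy → D R (x ∙⟨ dxy ⟩) z)
    D-assocˡ {x} {y} {z} ((v , Rvyz) , (u , Ruxv))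
      with Equivalence.to (assoc u x y z) (v , Ruxv , Rvyz)
    ... | w , Ruwz , Rwxy = (w , Rwxy) , (u , Ruwz)

    D-assoc : ∀ x y z → Σ (D R x y) (λ dxy → D R (x ∙⟨ dxy ⟩) z) ⇔
                        Σ (D R y z) (λ dyz → D R x (y ∙⟨ dyz ⟩))
    D-assoc _ _ _ = mk⇔ D-assocʳ D-assocˡ

  D-composite : IsCoherent R → ∀ {x y z} (dxy : D R x y) → D R y z →
                D R (x ∙⟨ dxy ⟩) z
  D-composite coherent (_ , Rwxy) = coherent Rwxy

  left-unit-exists : IsRelationalMonoid R → ∀ x → ∃[ e ] (InE R e × D R e x)
  left-unit-exists (_ , units) x = proj₁ (units x)

  right-unit-exists : IsRelationalMonoid R → ∀ x → ∃[ e ] (InE R e × D R x e)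
  right-unit-exists (_ , units) x = proj₂ (units x)

lemma3p4 : ∀ {a ℓ} {X : Set a} (R : Ternary X ℓ) → IsObjectFreeCategory R →
    let _·⟨_⟩ = _·⟨_⟩ R in
    (∀ x y z →
      (Σ (D R x y) λ dxy → D R (x ·⟨ dxy ⟩) z)
        ⇔ (Σ (D R y z) λ dyz → D R x (y ·⟨ dyz ⟩)))
    × (∀ x y z (dxy : D R x y) (dxy-z : D R (x ·⟨ dxy ⟩) z) →
         -- (x · y) · z = x · (y · z); the composites are witnesses of D,
         -- unique since R is a partial operation
         Σ (D R y z) λ dyz → Σ (D R x (y ·⟨ dyz ⟩)) λ dx-yz →
           (x ·⟨ dxy ⟩) ·⟨ dxy-z ⟩ ≡ x ·⟨ dx-yz ⟩)
    × ((∀ x → ∃[ e ] (InE R e × D R e x)) × (∀ x → ∃[ e ] (InE R e × D R x e)))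
    × (∀ x y z (dxy : D R x y) → D R y z → D R (x ·⟨ dxy ⟩) z)
lemma3p4 R ((monoid@(assoc , _) , _) , coherent) =
    D-assoc
  , (λ _ _ _ → ·-assoc)
  , (left-unit-exists monoid , right-unit-exists monoid)
  , (λ _ _ _ → D-composite coherent)
  where open RelationalSemigroup assoc
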